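{- For all types $A,B$: (1) $m(A\wedge B)>m(A)$; (2) $m(A\Rightarrow B)>m(A)$; (3) $m(A\Rightarrow B)>m(B)$; (4) if $A\equiv B$ then $m(A)=m(B)$.
   Context: Types are generated by $A ::= \tau \mid A\Rightarrow A \mid A\wedge A$, where $\tau$ is the only atomic type ($\Rightarrow$ associates to the right). Type equivalence $\equiv$ is the smallest congruence on types such that $A\wedge B\equiv B\wedge A$, $A\wedge(B\wedge C)\equiv(A\wedge B)\wedge C$, $A\Rightarrow(B\wedge C)\equiv(A\Rightarrow B)\wedge(A\Rightarrow C)$ and $(A\wedge B)\Rightarrow C\equiv A\Rightarrow B\Rightarrow C$. The multiset of prime factors is defined by $\mathrm{PF}(\tau)=[\tau]$, $\mathrm{PF}(A\wedge B)=\mathrm{PF}(A)\uplus\mathrm{PF}(B)$ (multiset union), and $\mathrm{PF}(A\Rightarrow B)=[(A\wedge B_i)\Rightarrow\tau]_{i=1}^n$ where $\mathrm{PF}(B)=[B_i\Rightarrow\tau]_{i=1}^n$; here $\tau$ is written $\emptyset\Rightarrow\tau$ and one uses the convention $A\wedge\emptyset=A$. The measure of a type is $m(A)=\sum_i(m(C_i)+1)$ where $\mathrm{PF}(A)=[C_i\Rightarrow\tau]_i$, with the convention $m(\emptyset)=0$. -}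

module Defs where

open import Data.Nat using (ℕ; zero; suc; _+_)
open import Data.List using (List; []; _∷_; _++_; map)
open import Data.Nat.ListAction using (sum)
open import Data.Maybe using (Maybe; nothing; just)

infixr 5 _⇒_
infixl 6 _∧_

data Ty : Set where
  τ   : Ty
  _⇒_ : Ty → Ty → Ty
  _∧_ : Ty → Ty → Ty

data _≡ᵀ_ : Ty → Ty → Set where
  ≡-refl   : ∀ {A} → A ≡ᵀ A
  ≡-sym    : ∀ {A B} → A ≡ᵀ B → B ≡ᵀ A
  ≡-trans  : ∀ {A B C} → A ≡ᵀ B → B ≡ᵀ C → A ≡ᵀ C
  ≡-cong∧  : ∀ {A A′ B B′} → A ≡ᵀ A′ → B ≡ᵀ B′ → (A ∧ B) ≡ᵀ (A′ ∧ B′)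
  ≡-cong⇒  : ∀ {A A′ B B′} → A ≡ᵀ A′ → B ≡ᵀ B′ → (A ⇒ B) ≡ᵀ (A′ ⇒ B′)
  ≡-comm   : ∀ {A B} → (A ∧ B) ≡ᵀ (B ∧ A)
  ≡-assoc  : ∀ {A B C} → (A ∧ (B ∧ C)) ≡ᵀ ((A ∧ B) ∧ C)
  ≡-distr  : ∀ {A B C} → (A ⇒ (B ∧ C)) ≡ᵀ ((A ⇒ B) ∧ (A ⇒ C))
  ≡-curry  : ∀ {A B C} → ((A ∧ B) ⇒ C) ≡ᵀ (A ⇒ B ⇒ C)

-- A prime factor C ⇒ τ is represented by its premise C : Maybe Ty,
-- where nothing stands for ∅ (so ∅ ⇒ τ is τ).
-- Multisets are represented as lists (only their sums are used).

_∧?_ : Ty → Maybe Ty → Ty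
A ∧? nothing = A
A ∧? just B  = A ∧ B

PF : Ty → List (Maybe Ty)
PF τ       = nothing ∷ []
PF (A ∧ B) = PF A ++ PF B
PF (A ⇒ B) = map (λ c → just (A ∧? c)) (PF B)

-- size of a type; every premise of a prime factor of A is strictly smaller
-- than A, so size A is sufficient fuel for computing the measure.
size : Ty → ℕ
size τ       = 1
size (A ⇒ B) = suc (size A + size B)
size (A ∧ B) = suc (size A + size B)

mutual
  mFuel : ℕ → Ty → ℕ
  mFuel zero    A = 0
  mFuel (suc n) A = sum (map (λ c → mPrem n c + 1) (PF A))

  mPrem : ℕ → Maybe Ty → ℕ
  mPrem n nothing  = 0
  mPrem n (just C) = mFuel n C

-- m(A) = Σ_i (m(C_i) + 1) where PF(A) = [C_i ⇒ τ]_i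
m : Ty → ℕ
m A = mFuel (size A) A

module Submission where

-- The measure m is defined by well-founded recursion through the list of
-- prime factors PF, with fuel.  We replace it by a closed form:
--   measure τ = 1,  measure (A ∧ B) = measure A + measure B,
--   measure (A ⇒ B) = factorCount B * measure A + measure B,
-- where factorCount A is the number of prime factors of A.  The last
-- equation holds because every prime factor (A ∧ C) ⇒ τ of A ⇒ B adds
-- m(A) to the contribution of the corresponding factor C ⇒ τ of B.
--
-- Invariance under ≡ᵀ then reduces to
-- checking the four axioms against ordinary arithmetic identities, and the
-- three strict inequalities follow from measure and factorCount being
-- positive.

open import Defs
open import Data.Nat using (ℕ; zero; suc; _+_; _*_; _<_; _≤_; s≤s; z≤n; >-nonZero)
open import Data.Nat.Properties
open import Data.Nat.ListAction using (sum)
open import Data.Nat.ListAction.Properties using (sum-++)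
open import Data.Nat.Tactic.RingSolver using (solve-∀)
open import Data.List using (List; []; _∷_; _++_; map; length)
open import Data.List.Properties using (length-map; length-++; map-++; map-∘; map-cong)
open import Data.Maybe using (Maybe; nothing; just)
open import Data.Product using (_×_; _,_)
open import Relation.Binary.PropositionalEquality

sum-map-shift : {X : Set} (k : ℕ) (f : X → ℕ) (xs : List X) →
  sum (map (λ x → k + f x) xs) ≡ length xs * k + sum (map f xs)
sum-map-shift k f []       = refl
sum-map-shift k f (x ∷ xs) = begin
  k + f x + sum (map (λ y → k + f y) xs)     ≡⟨ cong (k + f x +_) (sum-map-shift k f xs) ⟩
  k + f x + (length xs * k + sum (map f xs)) ≡⟨ rearrange k (f x) (length xs * k) (sum (map f xs)) ⟩
  k + length xs * k + (f x + sum (map f xs)) ∎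
  where
  open ≡-Reasoning
  rearrange : ∀ a b c d → a + b + (c + d) ≡ a + c + (b + d)
  rearrange = solve-∀

factorCount : Ty → ℕ
factorCount τ       = 1
factorCount (A ⇒ B) = factorCount B
factorCount (A ∧ B) = factorCount A + factorCount B

length-PF : ∀ A → length (PF A) ≡ factorCount A
length-PF τ       = refl
length-PF (A ⇒ B) = trans (length-map _ (PF B)) (length-PF B)
length-PF (A ∧ B) = trans (length-++ (PF A)) (cong₂ _+_ (length-PF A) (length-PF B))

measure : Ty → ℕ
measure τ       = 1
measure (A ⇒ B) = factorCount B * measure A + measure B
measure (A ∧ B) = measure A + measure B

mFuel-∧ : ∀ n A B → mFuel n (A ∧ B) ≡ mFuel n A + mFuel n B
mFuel-∧ zero    A B = refl
mFuel-∧ (suc n) A B = begin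
  sum (map weight (PF A ++ PF B))                   ≡⟨ cong sum (map-++ weight (PF A) (PF B)) ⟩
  sum (map weight (PF A) ++ map weight (PF B))      ≡⟨ sum-++ (map weight (PF A)) _ ⟩
  sum (map weight (PF A)) + sum (map weight (PF B)) ∎
  where
  open ≡-Reasoning
  weight : Maybe Ty → ℕ
  weight c = mPrem n c + 1

mFuel-∧? : ∀ n A c → mFuel n (A ∧? c) ≡ mFuel n A + mPrem n c
mFuel-∧? n A nothing  = sym (+-identityʳ _)
mFuel-∧? n A (just C) = mFuel-∧ n A C

-- Each prime factor (A ∧ C) ⇒ τ of A ⇒ B weighs m(A) more than the factor
-- C ⇒ τ of B it comes from; here with one unit of fuel less for A.
mFuel-⇒ : ∀ n A B → mFuel (suc n) (A ⇒ B) ≡ factorCount B * mFuel n A + mFuel (suc n) B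
mFuel-⇒ n A B = begin
  sum (map weight (map (λ c → just (A ∧? c)) (PF B)))  ≡⟨ cong sum (sym (map-∘ (PF B))) ⟩
  sum (map (λ c → mFuel n (A ∧? c) + 1) (PF B))         ≡⟨ cong sum (map-cong extend (PF B)) ⟩
  sum (map (λ c → mFuel n A + weight c) (PF B))         ≡⟨ sum-map-shift (mFuel n A) weight (PF B) ⟩
  length (PF B) * mFuel n A + mFuel (suc n) B           ≡⟨ cong (λ k → k * mFuel n A + mFuel (suc n) B) (length-PF B) ⟩
  factorCount B * mFuel n A + mFuel (suc n) B           ∎
  where
  open ≡-Reasoning
  weight : Maybe Ty → ℕ
  weight c = mPrem n c + 1
  extend : ∀ c → mFuel n (A ∧? c) + 1 ≡ mFuel n A + weight c
  extend c = trans (cong (_+ 1) (mFuel-∧? n A c)) (+-assoc (mFuel n A) (mPrem n c) 1)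

mFuel-adequate : ∀ A n → size A ≤ n → mFuel n A ≡ measure A
mFuel-adequate τ       (suc n) _        = refl
mFuel-adequate (A ∧ B) (suc n) (s≤s le) =
  trans (mFuel-∧ (suc n) A B)
        (cong₂ _+_ (mFuel-adequate A (suc n) (m≤n⇒m≤1+n (m+n≤o⇒m≤o (size A) le)))
                   (mFuel-adequate B (suc n) (m≤n⇒m≤1+n (m+n≤o⇒n≤o (size A) le))))
mFuel-adequate (A ⇒ B) (suc n) (s≤s le) =
  trans (mFuel-⇒ n A B)
        (cong₂ (λ a b → factorCount B * a + b)
               (mFuel-adequate A n (m+n≤o⇒m≤o (size A) le))
               (mFuel-adequate B (suc n) (m≤n⇒m≤1+n (m+n≤o⇒n≤o (size A) le))))

m≡measure : ∀ A → m A ≡ measure A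
m≡measure A = mFuel-adequate A (size A) ≤-refl

factorCount-invariant : ∀ {A B} → A ≡ᵀ B → factorCount A ≡ factorCount B
factorCount-invariant ≡-refl          = refl
factorCount-invariant (≡-sym e)       = sym (factorCount-invariant e)
factorCount-invariant (≡-trans e f)   = trans (factorCount-invariant e) (factorCount-invariant f)
factorCount-invariant (≡-cong∧ e f)   = cong₂ _+_ (factorCount-invariant e) (factorCount-invariant f)
factorCount-invariant (≡-cong⇒ _ f)   = factorCount-invariant f
factorCount-invariant (≡-comm {A})    = +-comm (factorCount A) _
factorCount-invariant (≡-assoc {A})   = sym (+-assoc (factorCount A) _ _)
factorCount-invariant ≡-distr         = refl
factorCount-invariant ≡-curry         = refl

measure-invariant : ∀ {A B} → A ≡ᵀ B → measure A ≡ measure B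
measure-invariant ≡-refl        = refl
measure-invariant (≡-sym e)     = sym (measure-invariant e)
measure-invariant (≡-trans e f) = trans (measure-invariant e) (measure-invariant f)
measure-invariant (≡-cong∧ e f) = cong₂ _+_ (measure-invariant e) (measure-invariant f)
measure-invariant (≡-cong⇒ e f) =
  cong₂ _+_ (cong₂ _*_ (factorCount-invariant f) (measure-invariant e)) (measure-invariant f)
measure-invariant (≡-comm {A})  = +-comm (measure A) _
measure-invariant (≡-assoc {A}) = sym (+-assoc (measure A) _ _)
measure-invariant (≡-distr {A} {B} {C}) =
  distr (measure A) (factorCount B) (factorCount C) (measure B) (measure C)
  where
  distr : ∀ a b c x y → (b + c) * a + (x + y) ≡ b * a + x + (c * a + y)
  distr = solve-∀
measure-invariant (≡-curry {A} {B} {C}) =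
  curry (measure A) (measure B) (factorCount C) (measure C)
  where
  curry : ∀ a b c z → c * (a + b) + z ≡ c * a + (c * b + z)
  curry = solve-∀

factorCount-positive : ∀ A → 0 < factorCount A
factorCount-positive τ       = s≤s z≤n
factorCount-positive (A ⇒ B) = factorCount-positive B
factorCount-positive (A ∧ B) = <-≤-trans (factorCount-positive A) (m≤m+n _ _)

measure-positive : ∀ A → 0 < measure A
measure-positive τ       = s≤s z≤n
measure-positive (A ⇒ B) = <-≤-trans (measure-positive B) (m≤n+m _ _)
measure-positive (A ∧ B) = <-≤-trans (measure-positive A) (m≤m+n _ _)

premise-counted : ∀ A B → measure A ≤ factorCount B * measure A
premise-counted A B = m≤n*m (measure A) (factorCount B) {{>-nonZero (factorCount-positive B)}}

mainTheorem18 : (A B : Ty) →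
    (m A < m (A ∧ B)) × (m A < m (A ⇒ B)) × (m B < m (A ⇒ B))
      × (A ≡ᵀ B → m A ≡ m B)
mainTheorem18 A B rewrite m≡measure A | m≡measure B | m≡measure (A ∧ B) | m≡measure (A ⇒ B) =
    m<m+n (measure A) (measure-positive B)
  , ≤-<-trans (premise-counted A B) (m<m+n _ (measure-positive B))
  , m<n+m (measure B) (<-≤-trans (measure-positive A) (premise-counted A B))
  , measure-invariant
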